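{- There exist absolute constants $c, C > 0$ and $n_0$ such that for every complete planar $3$-tree $T$ on $n \geq n_0$ vertices, $c \log n \leq mcc_3(T) \leq C \log n$; that is, $mcc_3(T) = \Theta(\log n)$.
   Context: For a graph $G$ and integer $t$, a $t$-coloring is an arbitrary assignment of one of $t$ colors to each vertex (adjacent vertices may share a color); a monochromatic connected component is a connected component of the subgraph induced by one color class; $mcc_t(G)$ is the smallest $m$ such that some $t$-coloring of $G$ has all monochromatic connected components of at most $m$ vertices. Complete planar $3$-trees are defined recursively: a $3$-cycle (embedded in the plane) is the complete planar $3$-tree with $0$ levels; for $k \geq 1$, the complete planar $3$-tree with $k$ levels is obtained from the one with $k-1$ levels by inserting a new vertex in every internal (bounded) face and joining it to the three vertices of that face. A complete planar $3$-tree with $k$ levels has $(3^k+5)/2$ vertices. -}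

module Defs where

open import Data.Nat using (ℕ; zero; suc; _≤_; _<_)
open import Data.Fin using (Fin)
open import Data.Product using (_×_; _,_; Σ; ∃)
open import Data.Sum using (_⊎_)
open import Data.List using (List; []; _∷_; length)
open import Data.List.Membership.Propositional using (_∈_)
open import Data.List.Relation.Unary.All using (All)
open import Data.List.Relation.Unary.Unique.Propositional using (Unique)
open import Relation.Binary.PropositionalEquality using (_≡_)

-- A finite simple graph on vertex set {0, …, size - 1}, given by an edge list.
record Graph : Set where
  constructor mkGraph
  field
    size  : ℕ
    edges : List (ℕ × ℕ)
open Graph public

Adj : Graph → ℕ → ℕ → Set
Adj G u v = (u , v) ∈ edges G ⊎ (v , u) ∈ edges G

Face : Set
Face = ℕ × ℕ × ℕ

record Stage : Set where
  constructor stage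
  field
    count : ℕ
    sedges : List (ℕ × ℕ)
    faces : List Face
open Stage public

insertAll : ℕ → List Face → ℕ × List (ℕ × ℕ) × List Face
insertAll v [] = v , [] , []
insertAll v ((a , b , c) ∷ fs) with insertAll (suc v) fs
... | (v' , es , fs') =
  v' , ((v , a) ∷ (v , b) ∷ (v , c) ∷ es) ,
  ((a , b , v) ∷ (b , c , v) ∷ (a , c , v) ∷ fs')

appendL : {A : Set} → List A → List A → List A
appendL [] ys = ys
appendL (x ∷ xs) ys = x ∷ appendL xs ys

levelStage : ℕ → Stage
levelStage zero = stage 3 ((0 , 1) ∷ (1 , 2) ∷ (0 , 2) ∷ []) ((0 , 1 , 2) ∷ [])
levelStage (suc k) with levelStage k
... | stage n es fs with insertAll n fs
...   | (n' , es' , fs') = stage n' (appendL es es') fs'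

completePlanar3Tree : ℕ → Graph
completePlanar3Tree k = mkGraph (count (levelStage k)) (sedges (levelStage k))

Coloring : ℕ → Set
Coloring t = ℕ → Fin t

data MonoPath (G : Graph) {t : ℕ} (χ : Coloring t) : ℕ → ℕ → Set where
  here : ∀ {u} → MonoPath G χ u u
  step : ∀ {u w v} → Adj G u w → χ u ≡ χ w → MonoPath G χ w v → MonoPath G χ u v

-- Every monochromatic connected component of G under χ has at most m
-- vertices: for each vertex v of G, any list of distinct vertices all in
-- the monochromatic component of v has length at most m.
AllMonoComponentsAtMost : (G : Graph) {t : ℕ} → Coloring t → ℕ → Set
AllMonoComponentsAtMost G χ m =
  ∀ (v : ℕ) → v < size G → (xs : List ℕ) → Unique xs →
  All (λ u → MonoPath G χ v u) xs → length xs ≤ m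

Achievable : Graph → ℕ → ℕ → Set
Achievable G t m = Σ (Coloring t) λ χ → AllMonoComponentsAtMost G χ m

IsMcc : Graph → ℕ → ℕ → Set
IsMcc G t m = Achievable G t m × (∀ m' → Achievable G t m' → m ≤ m')

-- Lower bound: follow a chain of nested faces, one per level. When a vertex w is inserted into the
-- current face, either w has the colour of a corner, or (with only three colours) two corners
-- share a colour and are adjacent; either way the monochromatic component of one corner reaches
-- another corner of a sub-face containing w, so descending into that sub-face loses nothing.
-- The three corner components of the face reached at level k thus cover k + 3 distinct vertices,
-- and one of them has at least (k + 3) / 3.
-- Upper bound: give each inserted vertex a colour different from those of the first two corners
-- a, b of its face, and also from that of c unless the face is rainbow; in that case it takes the
-- colour of c and joins its component, otherwise it founds a new component. Each component has at
-- most two rainbow faces whose third corner lies in it: such a face passes this role on to exactly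
-- one of its sub-faces, and a newly founded component gets at most two. So a component grows by at
-- most two vertices per level and has at most 2k + 1 vertices. Both bounds are linear in k, and
-- log₂ n lies between k and 2k + 2.
module Submission where

open import Defs
open import Data.Bool using (Bool; true; false; _∧_; not; if_then_else_)
open import Data.Bool.Properties using (∧-identityʳ; ∧-zeroʳ)
open import Data.Empty using (⊥-elim)
open import Data.Fin using (Fin; zero; suc) renaming (_≟_ to _≟ᶠ_)
open import Data.Fin.Properties using (all?)
open import Data.List using (List; []; _∷_; length; _++_; map)
open import Data.List.Membership.Propositional using (_∈_)
open import Data.List.Membership.Propositional.Properties using (∈-++⁺ˡ; ∈-++⁺ʳ; ∈-++⁻)
open import Data.List.Relation.Binary.Sublist.Propositional using (_⊆_; []; _∷_; _∷ʳ_)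
open import Data.List.Relation.Binary.Sublist.Propositional.Properties using (All-resp-⊆)
open import Data.List.Relation.Unary.All as All using (All; []; _∷_)
open import Data.List.Relation.Unary.AllPairs using ([]; _∷_)
open import Data.List.Relation.Unary.Any using (here; there)
open import Data.List.Relation.Unary.Unique.Propositional using (Unique)
open import Data.Nat
  using (ℕ; zero; suc; _+_; _*_; _^_; _≤_; _<_; _≤?_; _<?_; _≟_; _≤′_; ≤′-refl; ≤′-step; z≤n; s≤s)
open import Data.Nat.DivMod using (_mod_)
open import Data.Nat.ListAction using (sum)
open import Data.Nat.Logarithm using (⌊log₂_⌋; ⌊log₂⌋-mono-≤; ⌊log₂[2^n]⌋≡n)
open import Data.Nat.Properties
open import Algebra.Properties.CommutativeSemigroup +-commutativeSemigroup
  using () renaming (interchange to +-interchange)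
open import Data.Nat.Tactic.RingSolver using (solve-∀)
open import Data.Product using (_×_; _,_; proj₁; proj₂; ∃; ∃₂)
open import Data.Sum as Sum using (_⊎_; inj₁; inj₂; swap)
open import Function using (id; _∘_)
open import Relation.Binary.PropositionalEquality
open import Relation.Nullary using (yes; no; does)
open import Relation.Nullary.Decidable using (toWitness; _→-dec_; _⊎-dec_; ¬?; dec-true; dec-false)

private
  variable
    j k u v w : ℕ
    e : ℕ × ℕ
    F F′ : Face
    fs : List Face

module _ {A : Set} {P Q : A → Set} where

  split-⊎ : ∀ {xs} → All (λ x → P x ⊎ Q x) xs →
    ∃₂ λ ys zs → ys ⊆ xs × zs ⊆ xs × All P ys × All Q zs × length xs ≤ length ys + length zs
  split-⊎ [] = [] , [] , [] , [] , [] , [] , z≤n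
  split-⊎ {x ∷ xs} (inj₁ px ∷ pqs) with split-⊎ pqs
  ... | ys , zs , ys⊆ , zs⊆ , pys , qzs , len =
    x ∷ ys , zs , refl ∷ ys⊆ , x ∷ʳ zs⊆ , px ∷ pys , qzs , s≤s len
  split-⊎ {x ∷ xs} (inj₂ qx ∷ pqs) with split-⊎ pqs
  ... | ys , zs , ys⊆ , zs⊆ , pys , qzs , len =
    ys , x ∷ zs , x ∷ʳ ys⊆ , refl ∷ zs⊆ , pys , qx ∷ qzs ,
    ≤-trans (s≤s len) (≤-reflexive (sym (+-suc (length ys) (length zs))))

Unique-⊆ : ∀ {A : Set} {xs ys : List A} → ys ⊆ xs → Unique xs → Unique ys
Unique-⊆ []           []         = []
Unique-⊆ (_ ∷ʳ ys⊆)   (_ ∷ xs!)  = Unique-⊆ ys⊆ xs!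
Unique-⊆ (refl ∷ ys⊆) (x∉ ∷ xs!) = All-resp-⊆ ys⊆ x∉ ∷ Unique-⊆ ys⊆ xs!

unique-length-⊎ : ∀ {A : Set} {P Q : A → Set} {xs p q} → Unique xs → All (λ x → P x ⊎ Q x) xs →
  (∀ {ys} → Unique ys → All P ys → length ys ≤ p) →
  (∀ {zs} → Unique zs → All Q zs → length zs ≤ q) →
  length xs ≤ p + q
unique-length-⊎ xs! pqs P-bound Q-bound with split-⊎ pqs
... | ys , zs , ys⊆ , zs⊆ , pys , qzs , len =
  ≤-trans len (+-mono-≤ (P-bound (Unique-⊆ ys⊆ xs!) pys) (Q-bound (Unique-⊆ zs⊆ xs!) qzs))

𝟙 : Bool → ℕ
𝟙 true  = 1
𝟙 false = 0

𝟙≤1 : ∀ b → 𝟙 b ≤ 1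
𝟙≤1 true  = ≤-refl
𝟙≤1 false = z≤n

𝟙-∧ : ∀ b c → 𝟙 (b ∧ c) ≡ 𝟙 b * 𝟙 c
𝟙-∧ true  c = sym (*-identityˡ (𝟙 c))
𝟙-∧ false c = refl

countFrom : (ℕ → Bool) → ℕ → ℕ → ℕ
countFrom p v zero    = 0
countFrom p v (suc n) = 𝟙 (p v) + countFrom p (suc v) n

countFrom-+ : ∀ p v m n → countFrom p v (m + n) ≡ countFrom p v m + countFrom p (v + m) n
countFrom-+ p v zero    n = cong (λ v′ → countFrom p v′ n) (sym (+-identityʳ v))
countFrom-+ p v (suc m) n = begin
  𝟙 (p v) + countFrom p (suc v) (m + n)
    ≡⟨ cong (𝟙 (p v) +_) (countFrom-+ p (suc v) m n) ⟩
  𝟙 (p v) + (countFrom p (suc v) m + countFrom p (suc v + m) n)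
    ≡⟨ +-assoc (𝟙 (p v)) _ _ ⟨
  countFrom p v (suc m) + countFrom p (suc (v + m)) n
    ≡⟨ cong (λ v′ → countFrom p v (suc m) + countFrom p v′ n) (+-suc v m) ⟨
  countFrom p v (suc m) + countFrom p (v + suc m) n ∎
  where open ≡-Reasoning

countFrom-cong : ∀ {p q} v n → (∀ u → v ≤ u → u < v + n → p u ≡ q u) →
  countFrom p v n ≡ countFrom q v n
countFrom-cong v zero    p≗q = refl
countFrom-cong v (suc n) p≗q = cong₂ _+_
  (cong 𝟙 (p≗q v ≤-refl (m<m+n v (s≤s z≤n))))
  (countFrom-cong (suc v) n λ u v<u u< → p≗q u (<⇒≤ v<u) (≤-trans u< (≤-reflexive (sym (+-suc v n)))))

countFrom-none : ∀ {p} v n → (∀ u → v ≤ u → u < v + n → p u ≡ false) → countFrom p v n ≡ 0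
countFrom-none v n none = trans (countFrom-cong v n none) (countFrom-false v n)
  where
  countFrom-false : ∀ v n → countFrom (λ _ → false) v n ≡ 0
  countFrom-false v zero    = refl
  countFrom-false v (suc n) = countFrom-false (suc v) n

is : ℕ → ℕ → Bool
is X u = does (u ≟ X)

countFrom-is : ∀ X v n → countFrom (is X) v n ≤ 1
countFrom-is X v zero = z≤n
countFrom-is X v (suc n) with v ≟ X
... | yes refl = ≤-reflexive (cong₂ _+_ (cong 𝟙 (dec-true (v ≟ v) refl))
                                       (countFrom-none (suc v) n λ u v<u _ → dec-false (u ≟ v) (>⇒≢ v<u)))
... | no v≢X   = subst (λ b → 𝟙 b + countFrom (is X) (suc v) n ≤ 1) (sym (dec-false (v ≟ X) v≢X))
                       (countFrom-is X (suc v) n)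

countFrom-is-below : ∀ {X} v n → X < v → countFrom (is X) v n ≡ 0
countFrom-is-below {X} v n X<v =
  countFrom-none v n λ u v≤u _ → dec-false (u ≟ X) (>⇒≢ (<-≤-trans X<v v≤u))

_∖_ : (ℕ → Bool) → ℕ → (ℕ → Bool)
(p ∖ x) u = p u ∧ not (is x u)

∖-self : ∀ p x → (p ∖ x) x ≡ false
∖-self p x = trans (cong (λ b → p x ∧ not b) (dec-true (x ≟ x) refl)) (∧-zeroʳ (p x))

∖-≢ : ∀ p {x u} → u ≢ x → (p ∖ x) u ≡ p u
∖-≢ p {x} {u} u≢x = trans (cong (λ b → p u ∧ not b) (dec-false (u ≟ x) u≢x)) (∧-identityʳ (p u))

countFrom-∖ : ∀ {p x} v n → v ≤ x → x < v + n → p x ≡ true →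
  countFrom p v n ≡ suc (countFrom (p ∖ x) v n)
countFrom-∖ v zero v≤x x< px = ⊥-elim (<⇒≱ (subst (_ <_) (+-identityʳ v) x<) v≤x)
countFrom-∖ {p} {x} v (suc n) v≤x x< px with v ≟ x
... | yes refl = begin
  𝟙 (p v) + countFrom p (suc v) n
    ≡⟨ cong₂ _+_ (cong 𝟙 px) (countFrom-cong (suc v) n λ u v<u _ → sym (∖-≢ p (>⇒≢ v<u))) ⟩
  suc (countFrom (p ∖ v) (suc v) n)
    ≡⟨ cong (λ b → suc (𝟙 b + countFrom (p ∖ v) (suc v) n)) (∖-self p v) ⟨
  suc (countFrom (p ∖ v) v (suc n)) ∎
  where open ≡-Reasoning
... | no v≢x = begin
  𝟙 (p v) + countFrom p (suc v) n
    ≡⟨ cong (𝟙 (p v) +_) (countFrom-∖ (suc v) n (≤∧≢⇒< v≤x v≢x) (≤-trans x< (≤-reflexive (+-suc v n))) px) ⟩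
  𝟙 (p v) + suc (countFrom (p ∖ x) (suc v) n)
    ≡⟨ +-suc _ _ ⟩
  suc (𝟙 (p v) + countFrom (p ∖ x) (suc v) n)
    ≡⟨ cong (λ b → suc (𝟙 b + countFrom (p ∖ x) (suc v) n)) (∖-≢ p v≢x) ⟨
  suc (countFrom (p ∖ x) v (suc n)) ∎
  where open ≡-Reasoning

unique-≤-countFrom : ∀ {p N xs} → Unique xs → All (λ u → u < N × p u ≡ true) xs →
  length xs ≤ countFrom p 0 N
unique-≤-countFrom [] [] = z≤n
unique-≤-countFrom {p} {N} {x ∷ xs} (x∉ ∷ xs!) ((x< , px) ∷ ok) =
  ≤-trans (s≤s (unique-≤-countFrom xs! (All.zipWith keep (x∉ , ok))))
          (≤-reflexive (sym (countFrom-∖ 0 N z≤n x< px)))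
  where
  keep : ∀ {y} → x ≢ y × (y < N × p y ≡ true) → y < N × (p ∖ x) y ≡ true
  keep (x≢y , y< , py) = y< , trans (∖-≢ p (x≢y ∘ sym)) py

three-colours : (w a b c : Fin 3) → w ≢ a → w ≢ b → w ≢ c → a ≡ b ⊎ b ≡ c ⊎ a ≡ c
three-colours = toWitness {a? = all? λ w → all? λ a → all? λ b → all? λ c →
  ¬? (w ≟ᶠ a) →-dec (¬? (w ≟ᶠ b) →-dec (¬? (w ≟ᶠ c) →-dec
  (a ≟ᶠ b ⊎-dec (b ≟ᶠ c ⊎-dec a ≟ᶠ c))))} _

other : Fin 3 → Fin 3 → Fin 3
other zero             (suc zero) = suc (suc zero)
other zero             _          = suc zero
other (suc zero)       zero       = suc (suc zero)
other (suc zero)       _          = zero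
other (suc (suc zero)) zero       = suc zero
other (suc (suc zero)) _          = zero

-- Differs from x and y, and equals z exactly when x, y, z are pairwise distinct.
newColour : Fin 3 → Fin 3 → Fin 3 → Fin 3
newColour x y z = if does (x ≟ᶠ y) then other x z else other x y

joins : Fin 3 → Fin 3 → Fin 3 → Bool
joins x y z = does (newColour x y z ≟ᶠ z)

newColour-≢₁ : ∀ x y z → newColour x y z ≢ x
newColour-≢₁ = toWitness {a? = all? λ x → all? λ y → all? λ z → ¬? (newColour x y z ≟ᶠ x)} _

newColour-≢₂ : ∀ x y z → newColour x y z ≢ y
newColour-≢₂ = toWitness {a? = all? λ x → all? λ y → all? λ z → ¬? (newColour x y z ≟ᶠ y)} _

-- The sub-faces (a, b, w), (b, c, w), (a, c, w) of a face coloured (x, y, z), w coloured n.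
joining-subFaces : ∀ x y z → let n = newColour x y z in
  𝟙 (joins x y n) + 𝟙 (joins y z n) + 𝟙 (joins x z n) ≤ (if joins x y z then 1 else 2)
joining-subFaces = toWitness {a? = all? λ x → all? λ y → all? λ z → let n = newColour x y z in
  𝟙 (joins x y n) + 𝟙 (joins y z n) + 𝟙 (joins x z n) ≤? (if joins x y z then 1 else 2)} _

-- Inserting vertices into faces

nextLabel : ℕ → List Face → ℕ
nextLabel v fs = proj₁ (insertAll v fs)

newEdges : ℕ → List Face → List (ℕ × ℕ)
newEdges v fs = proj₁ (proj₂ (insertAll v fs))

newFaces : ℕ → List Face → List Face
newFaces v fs = proj₂ (proj₂ (insertAll v fs))

data Inserts : ℕ → List Face → ℕ → Face → Set where
  here  : Inserts v (F ∷ fs) v F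
  there : Inserts (suc v) fs w F → Inserts v (F′ ∷ fs) w F

data SubFace (w : ℕ) : Face → Face → Set where
  drop-c : ∀ {a b c} → SubFace w (a , b , c) (a , b , w)
  drop-a : ∀ {a b c} → SubFace w (a , b , c) (b , c , w)
  drop-b : ∀ {a b c} → SubFace w (a , b , c) (a , c , w)

data Spoke (w : ℕ) : Face → ℕ × ℕ → Set where
  to-a : ∀ {a b c} → Spoke w (a , b , c) (w , a)
  to-b : ∀ {a b c} → Spoke w (a , b , c) (w , b)
  to-c : ∀ {a b c} → Spoke w (a , b , c) (w , c)

nextLabel≡ : ∀ v fs → nextLabel v fs ≡ v + length fs
nextLabel≡ v []       = sym (+-identityʳ v)
nextLabel≡ v (F ∷ fs) = trans (nextLabel≡ (suc v) fs) (sym (+-suc v (length fs)))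

length-newFaces : ∀ v fs → length (newFaces v fs) ≡ 3 * length fs
length-newFaces v []       = refl
length-newFaces v (F ∷ fs) = trans (cong (3 +_) (length-newFaces (suc v) fs)) (sym (*-suc 3 (length fs)))

Inserts⇒∈ : Inserts v fs w F → F ∈ fs
Inserts⇒∈ here        = here refl
Inserts⇒∈ (there ins) = there (Inserts⇒∈ ins)

Inserts⇒label-range : Inserts v fs w F → v ≤ w × w < v + length fs
Inserts⇒label-range {v} {F ∷ fs} here        = ≤-refl , m<m+n v (s≤s z≤n)
Inserts⇒label-range {v} {F ∷ fs} (there ins) with Inserts⇒label-range ins
... | v<w , w<end = <⇒≤ v<w , ≤-trans w<end (≤-reflexive (sym (+-suc v (length fs))))

∈⇒Inserts : ∀ v → F ∈ fs → ∃ λ w → Inserts v fs w F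
∈⇒Inserts v (here refl) = v , here
∈⇒Inserts v (there F∈) with ∈⇒Inserts (suc v) F∈
... | w , ins = w , there ins

Inserts⇒spoke∈ : Inserts v fs w F → Spoke w F e → e ∈ newEdges v fs
Inserts⇒spoke∈ here        to-a = here refl
Inserts⇒spoke∈ here        to-b = there (here refl)
Inserts⇒spoke∈ here        to-c = there (there (here refl))
Inserts⇒spoke∈ (there ins) spk  = there (there (there (Inserts⇒spoke∈ ins spk)))

Inserts⇒subFace∈ : Inserts v fs w F → SubFace w F F′ → F′ ∈ newFaces v fs
Inserts⇒subFace∈ here        drop-c = here refl
Inserts⇒subFace∈ here        drop-a = there (here refl)
Inserts⇒subFace∈ here        drop-b = there (there (here refl))
Inserts⇒subFace∈ (there ins) sub    = there (there (there (Inserts⇒subFace∈ ins sub)))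

newEdge⇒spoke : ∀ v fs → e ∈ newEdges v fs → ∃₂ λ w F → Inserts v fs w F × Spoke w F e
newEdge⇒spoke v (F ∷ fs) (here refl)                 = v , F , here , to-a
newEdge⇒spoke v (F ∷ fs) (there (here refl))         = v , F , here , to-b
newEdge⇒spoke v (F ∷ fs) (there (there (here refl))) = v , F , here , to-c
newEdge⇒spoke v (F ∷ fs) (there (there (there e∈))) with newEdge⇒spoke (suc v) fs e∈
... | w , F′ , ins , spk = w , F′ , there ins , spk

newFace⇒subFace : ∀ v fs → F′ ∈ newFaces v fs → ∃₂ λ w F → Inserts v fs w F × SubFace w F F′
newFace⇒subFace v (F ∷ fs) (here refl)                 = v , F , here , drop-c
newFace⇒subFace v (F ∷ fs) (there (here refl))         = v , F , here , drop-a
newFace⇒subFace v (F ∷ fs) (there (there (here refl))) = v , F , here , drop-b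
newFace⇒subFace v (F ∷ fs) (there (there (there F∈))) with newFace⇒subFace (suc v) fs F∈
... | w , F″ , ins , sub = w , F″ , there ins , sub

extend : {A : Set} → (ℕ → Face → A) → (ℕ → A) → ℕ → List Face → ℕ → A
extend new old v []       u = old u
extend new old v (F ∷ fs) u with u ≟ v
... | yes _ = new v F
... | no _  = extend new old (suc v) fs u

module _ {A : Set} {new : ℕ → Face → A} {old : ℕ → A} where

  extend-old : ∀ v fs → u < v → extend new old v fs u ≡ old u
  extend-old     v []       u<v = refl
  extend-old {u} v (F ∷ fs) u<v with u ≟ v
  ... | yes refl = ⊥-elim (<-irrefl refl u<v)
  ... | no _     = extend-old (suc v) fs (m<n⇒m<1+n u<v)

  extend-new : Inserts v fs w F → extend new old v fs w ≡ new w F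
  extend-new {v} here with v ≟ v
  ... | yes _  = refl
  ... | no v≢v = ⊥-elim (v≢v refl)
  extend-new {v} {w = w} (there ins) with w ≟ v
  ... | yes refl = ⊥-elim (<-irrefl refl (proj₁ (Inserts⇒label-range ins)))
  ... | no _     = extend-new ins

  extend-cases : ∀ v fs u →
    extend new old v fs u ≡ old u ⊎ ∃ λ F → Inserts v fs u F × extend new old v fs u ≡ new u F
  extend-cases v []       u = inj₁ refl
  extend-cases v (F ∷ fs) u with u ≟ v
  ... | yes refl = inj₂ (F , here , refl)
  ... | no _ with extend-cases (suc v) fs u
  ...   | inj₁ eq              = inj₁ eq
  ...   | inj₂ (F′ , ins , eq) = inj₂ (F′ , there ins , eq)

Corners : (ℕ → Set) → Face → Set
Corners P (a , b , c) = P a × P b × P c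

Triangle : Graph → Face → Set
Triangle G (a , b , c) = Adj G a b × Adj G b c × Adj G a c

Spokes : Graph → ℕ → Face → Set
Spokes G w (a , b , c) = Adj G w a × Adj G w b × Adj G w c

record _⊆ᴱ_ (G H : Graph) : Set where
  constructor edges⊆
  field ∈-edges : e ∈ edges G → e ∈ edges H
open _⊆ᴱ_

Adj-⊆ : ∀ {G H x y} → G ⊆ᴱ H → Adj G x y → Adj H x y
Adj-⊆ G⊆H = Sum.map (∈-edges G⊆H) (∈-edges G⊆H)

Triangle-⊆ : ∀ {G H} → G ⊆ᴱ H → Triangle G F → Triangle H F
Triangle-⊆ {a , b , c} G⊆H (ab , bc , ac) = Adj-⊆ G⊆H ab , Adj-⊆ G⊆H bc , Adj-⊆ G⊆H ac

Spokes-⊆ : ∀ {G H} → G ⊆ᴱ H → Spokes G w F → Spokes H w F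
Spokes-⊆ {w} {a , b , c} G⊆H (wa , wb , wc) = Adj-⊆ G⊆H wa , Adj-⊆ G⊆H wb , Adj-⊆ G⊆H wc

subFace-corners : ∀ {P} → Corners P F → P w → SubFace w F F′ → Corners P F′
subFace-corners (pa , pb , pc) pw drop-c = pa , pb , pw
subFace-corners (pa , pb , pc) pw drop-a = pb , pc , pw
subFace-corners (pa , pb , pc) pw drop-b = pa , pc , pw

subFace-triangle : ∀ {G} → Triangle G F → Spokes G w F → SubFace w F F′ → Triangle G F′
subFace-triangle (ab , bc , ac) (wa , wb , wc) drop-c = ab , swap wb , swap wa
subFace-triangle (ab , bc , ac) (wa , wb , wc) drop-a = bc , swap wc , swap wb
subFace-triangle (ab , bc , ac) (wa , wb , wc) drop-b = ac , swap wc , swap wa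

-- The levels of the construction

tree : ℕ → Graph
tree = completePlanar3Tree

order : ℕ → ℕ
order k = size (tree k)

innerFaces : ℕ → List Face
innerFaces k = faces (levelStage k)

appendL≡++ : ∀ {A : Set} (xs ys : List A) → appendL xs ys ≡ xs ++ ys
appendL≡++ []       ys = refl
appendL≡++ (x ∷ xs) ys = cong (x ∷_) (appendL≡++ xs ys)

edges-suc : ∀ j → edges (tree (suc j)) ≡ edges (tree j) ++ newEdges (order j) (innerFaces j)
edges-suc j = appendL≡++ (edges (tree j)) _

length-innerFaces : ∀ j → length (innerFaces j) ≡ 3 ^ j
length-innerFaces zero    = refl
length-innerFaces (suc j) = trans (length-newFaces (order j) (innerFaces j)) (cong (3 *_) (length-innerFaces j))

order-suc : ∀ j → order (suc j) ≡ order j + 3 ^ j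
order-suc j = trans (nextLabel≡ (order j) (innerFaces j)) (cong (order j +_) (length-innerFaces j))

<-order-suc : ∀ j {x} → x < order j → x < order (suc j)
<-order-suc j x< = <-≤-trans x< (≤-trans (m≤m+n (order j) (3 ^ j)) (≤-reflexive (sym (order-suc j))))

Corners-order-suc : ∀ j → Corners (_< order j) F → Corners (_< order (suc j)) F
Corners-order-suc j (a< , b< , c<) = <-order-suc j a< , <-order-suc j b< , <-order-suc j c<

tree-⊆-suc : ∀ j → tree j ⊆ᴱ tree (suc j)
tree-⊆-suc j = edges⊆ λ e∈ → subst (_ ∈_) (sym (edges-suc j)) (∈-++⁺ˡ e∈)

tree-⊆ : j ≤ k → tree j ⊆ᴱ tree k
tree-⊆ j≤k = go (≤⇒≤′ j≤k)
  where
  go : j ≤′ k → tree j ⊆ᴱ tree k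
  go ≤′-refl            = edges⊆ id
  go (≤′-step {n} j≤′n) = edges⊆ (∈-edges (tree-⊆-suc n) ∘ ∈-edges (go j≤′n))

inserted-label : ∀ j → Inserts (order j) (innerFaces j) w F → order j ≤ w × w < order (suc j)
inserted-label j ins with Inserts⇒label-range ins
... | j≤w , w<end = j≤w , ≤-trans w<end (≤-reflexive (sym (nextLabel≡ (order j) (innerFaces j))))

inserted-spokes : ∀ j → Inserts (order j) (innerFaces j) w F → Spokes (tree (suc j)) w F
inserted-spokes {w} {a , b , c} j ins = spoke to-a , spoke to-b , spoke to-c
  where
  spoke : ∀ {x} → Spoke w (a , b , c) (w , x) → Adj (tree (suc j)) w x
  spoke s = inj₁ (subst (_ ∈_) (sym (edges-suc j)) (∈-++⁺ʳ (edges (tree j)) (Inserts⇒spoke∈ ins s)))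

innerFace-corners : ∀ j → F ∈ innerFaces j → Corners (_< order j) F
innerFace-corners zero    (here refl) = s≤s z≤n , s≤s (s≤s z≤n) , s≤s (s≤s (s≤s z≤n))
innerFace-corners (suc j) F∈ with newFace⇒subFace (order j) (innerFaces j) F∈
... | w , F₀ , ins , sub =
  subFace-corners (Corners-order-suc j (innerFace-corners j (Inserts⇒∈ ins))) (proj₂ (inserted-label j ins)) sub

innerFace-triangle : ∀ j → F ∈ innerFaces j → Triangle (tree j) F
innerFace-triangle zero    (here refl) =
  inj₁ (here refl) , inj₁ (there (here refl)) , inj₁ (there (there (here refl)))
innerFace-triangle (suc j) F∈ with newFace⇒subFace (order j) (innerFaces j) F∈
... | w , F₀ , ins , sub = subFace-triangle {G = tree (suc j)}
  (Triangle-⊆ (tree-⊆-suc j) (innerFace-triangle j (Inserts⇒∈ ins))) (inserted-spokes j ins) sub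

edge-ends : ∀ j {x y} → (x , y) ∈ edges (tree j) → x < order j × y < order j
edge-ends zero (here refl)                 = s≤s z≤n , s≤s (s≤s z≤n)
edge-ends zero (there (here refl))         = s≤s (s≤s z≤n) , s≤s (s≤s (s≤s z≤n))
edge-ends zero (there (there (here refl))) = s≤s z≤n , s≤s (s≤s (s≤s z≤n))
edge-ends (suc j) e∈ with ∈-++⁻ (edges (tree j)) (subst (_ ∈_) (edges-suc j) e∈)
... | inj₁ old with edge-ends j old
...   | x< , y< = <-order-suc j x< , <-order-suc j y<
edge-ends (suc j) e∈ | inj₂ new with newEdge⇒spoke (order j) (innerFaces j) new
... | w , F , ins , spk = ends (innerFace-corners j (Inserts⇒∈ ins)) spk
  where
  w< : w < order (suc j)
  w< = proj₂ (inserted-label j ins)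
  ends : ∀ {F x y} → Corners (_< order j) F → Spoke w F (x , y) → x < order (suc j) × y < order (suc j)
  ends (a< , _  , _ ) to-a = w< , <-order-suc j a<
  ends (_  , b< , _ ) to-b = w< , <-order-suc j b<
  ends (_  , _  , c<) to-c = w< , <-order-suc j c<

order-≥ : ∀ k → 2 ^ k ≤ order k
order-≥ zero    = s≤s z≤n
order-≥ (suc k) = begin
  2 ^ k + (2 ^ k + 0)  ≡⟨ cong (2 ^ k +_) (+-identityʳ (2 ^ k)) ⟩
  2 ^ k + 2 ^ k        ≤⟨ +-mono-≤ (order-≥ k) (^-monoˡ-≤ k (s≤s (s≤s z≤n))) ⟩
  order k + 3 ^ k      ≡⟨ order-suc k ⟨
  order (suc k)        ∎
  where open ≤-Reasoning

order-≤ : ∀ k → order k ≤ 4 ^ suc k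
order-≤ zero    = s≤s (s≤s (s≤s z≤n))
order-≤ (suc k) = begin
  order (suc k)          ≡⟨ order-suc k ⟩
  order k + 3 ^ k        ≤⟨ +-mono-≤ (order-≤ k) (≤-trans (^-monoˡ-≤ k (s≤s (s≤s (s≤s z≤n)))) (m≤m+n (4 ^ k) _)) ⟩
  4 ^ suc k + 4 ^ suc k  ≤⟨ +-monoʳ-≤ (4 ^ suc k) (m≤m+n (4 ^ suc k) _) ⟩
  4 ^ suc (suc k)        ∎
  where open ≤-Reasoning

log-order-≥ : ∀ k → k ≤ ⌊log₂ order k ⌋
log-order-≥ k = subst (_≤ ⌊log₂ order k ⌋) (⌊log₂[2^n]⌋≡n k) (⌊log₂⌋-mono-≤ (order-≥ k))

log-order-≤ : ∀ k → ⌊log₂ order k ⌋ ≤ 2 * suc k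
log-order-≤ k = begin
  ⌊log₂ order k ⌋          ≤⟨ ⌊log₂⌋-mono-≤ (order-≤ k) ⟩
  ⌊log₂ 4 ^ suc k ⌋        ≡⟨ cong ⌊log₂_⌋ (^-*-assoc 2 2 (suc k)) ⟩
  ⌊log₂ 2 ^ (2 * suc k) ⌋  ≡⟨ ⌊log₂[2^n]⌋≡n (2 * suc k) ⟩
  2 * suc k                ∎
  where open ≤-Reasoning

-- The lower bound

module LowerBound (K : ℕ) (χ : Coloring 3) where

  _~_ : ℕ → ℕ → Set
  x ~ y = MonoPath (tree K) χ x y

  ReachedFrom : Face → ℕ → Set
  ReachedFrom (a , b , c) u = a ~ u ⊎ b ~ u ⊎ c ~ u

  dropped : SubFace w F F′ → ℕ
  dropped (drop-c {c = c}) = c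
  dropped (drop-a {a = a}) = a
  dropped (drop-b {b = b}) = b

  ReachedFrom-subFace : (sub : SubFace w F F′) → (∀ {u} → dropped sub ~ u → ReachedFrom F′ u) →
    ∀ {u} → ReachedFrom F u → ReachedFrom F′ u
  ReachedFrom-subFace drop-c f (inj₁ a~u)        = inj₁ a~u
  ReachedFrom-subFace drop-c f (inj₂ (inj₁ b~u)) = inj₂ (inj₁ b~u)
  ReachedFrom-subFace drop-c f (inj₂ (inj₂ c~u)) = f c~u
  ReachedFrom-subFace drop-a f (inj₁ a~u)        = f a~u
  ReachedFrom-subFace drop-a f (inj₂ (inj₁ b~u)) = inj₁ b~u
  ReachedFrom-subFace drop-a f (inj₂ (inj₂ c~u)) = inj₂ (inj₁ c~u)
  ReachedFrom-subFace drop-b f (inj₁ a~u)        = inj₁ a~u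
  ReachedFrom-subFace drop-b f (inj₂ (inj₁ b~u)) = f b~u
  ReachedFrom-subFace drop-b f (inj₂ (inj₂ c~u)) = inj₂ (inj₁ c~u)

  subFace-reaches-new : SubFace w F F′ → ReachedFrom F′ w
  subFace-reaches-new drop-c = inj₂ (inj₂ here)
  subFace-reaches-new drop-a = inj₂ (inj₂ here)
  subFace-reaches-new drop-b = inj₂ (inj₂ here)

  ReachPreservingSubFace : ℕ → Face → Set
  ReachPreservingSubFace w F = ∃ λ F′ → SubFace w F F′ × (∀ {u} → ReachedFrom F u → ReachedFrom F′ u)

  absorb : (sub : SubFace w F F′) → (∀ {u} → dropped sub ~ u → ReachedFrom F′ u) →
    ReachPreservingSubFace w F
  absorb sub f = _ , sub , ReachedFrom-subFace sub f

  absorbing-subFace : Triangle (tree K) F → Spokes (tree K) w F → ReachPreservingSubFace w F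
  absorbing-subFace {a , b , c} {w} (ab , bc , ac) (wa , wb , wc)
    with χ w ≟ᶠ χ a | χ w ≟ᶠ χ b | χ w ≟ᶠ χ c
  ... | yes w≡a | _       | _       = absorb drop-a λ a~u → inj₂ (inj₂ (step wa w≡a a~u))
  ... | no _    | yes w≡b | _       = absorb drop-b λ b~u → inj₂ (inj₂ (step wb w≡b b~u))
  ... | no _    | no _    | yes w≡c = absorb drop-c λ c~u → inj₂ (inj₂ (step wc w≡c c~u))
  ... | no w≢a  | no w≢b  | no w≢c  with three-colours (χ w) (χ a) (χ b) (χ c) w≢a w≢b w≢c
  ...   | inj₁ a≡b        = absorb drop-a λ a~u → inj₁ (step (swap ab) (sym a≡b) a~u)
  ...   | inj₂ (inj₁ b≡c) = absorb drop-b λ b~u → inj₂ (inj₁ (step (swap bc) (sym b≡c) b~u))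
  ...   | inj₂ (inj₂ a≡c) = absorb drop-c λ c~u → inj₁ (step ac a≡c c~u)

  record Descent (j : ℕ) : Set where
    field
      face      : Face
      face∈     : face ∈ innerFaces j
      reached   : List ℕ
      distinct  : Unique reached
      old       : All (_< order j) reached
      long      : 3 + j ≤ length reached
      reachable : All (ReachedFrom face) reached

  descent-base : Descent 0
  descent-base = record
    { face      = 0 , 1 , 2
    ; face∈     = here refl
    ; reached   = 0 ∷ 1 ∷ 2 ∷ []
    ; distinct  = ((λ ()) ∷ (λ ()) ∷ []) ∷ ((λ ()) ∷ []) ∷ [] ∷ []
    ; old       = s≤s z≤n ∷ s≤s (s≤s z≤n) ∷ s≤s (s≤s (s≤s z≤n)) ∷ []
    ; long      = ≤-refl
    ; reachable = inj₁ here ∷ inj₂ (inj₁ here) ∷ inj₂ (inj₂ here) ∷ []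
    }

  module _ {j} (j<K : j < K) (d : Descent j) where
    open Descent d

    descent-step : Descent (suc j)
    descent-step with ∈⇒Inserts (order j) face∈
    ... | w , ins with inserted-label j ins
    ...   | j≤w , w< with absorbing-subFace (Triangle-⊆ (tree-⊆ (<⇒≤ j<K)) (innerFace-triangle j face∈))
                                            (Spokes-⊆ (tree-⊆ j<K) (inserted-spokes j ins))
    ...     | F′ , sub , grow = record
      { face      = F′
      ; face∈     = Inserts⇒subFace∈ ins sub
      ; reached   = w ∷ reached
      ; distinct  = All.map (λ x< → >⇒≢ (<-≤-trans x< j≤w)) old ∷ distinct
      ; old       = w< ∷ All.map (<-order-suc j) old
      ; long      = s≤s long
      ; reachable = subFace-reaches-new sub ∷ All.map grow reachable
      }

  descent : ∀ j → j ≤ K → Descent j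
  descent zero    _   = descent-base
  descent (suc j) j<K = descent-step j<K (descent j (<⇒≤ j<K))

  reached-≤ : ∀ {m xs} → AllMonoComponentsAtMost (tree K) χ m → Corners (_< order K) F →
    Unique xs → All (ReachedFrom F) xs → length xs ≤ 3 * m
  reached-≤ {a , b , c} {m} small (a< , b< , c<) xs! reached =
    ≤-trans (unique-length-⊎ xs! reached (small a a< _)
              λ ys! bc-reached → unique-length-⊎ ys! bc-reached (small b b< _) (small c c< _))
            (≤-reflexive (cong (λ n → m + (m + n)) (sym (+-identityʳ m))))

  large-component : ∀ {m} → AllMonoComponentsAtMost (tree K) χ m → 3 + K ≤ 3 * m
  large-component small = ≤-trans long (reached-≤ small (innerFace-corners K face∈) distinct reachable)
    where open Descent (descent K ≤-refl)

-- The upper bound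

-- A vertex carries its colour and the root of its monochromatic component, the vertex that founded it.
record Paint : Set where
  constructor paint
  field
    colour : Fin 3
    root   : ℕ
open Paint

Painting : Set
Painting = ℕ → Paint

joinsAt : Painting → Face → Bool
joinsAt p (a , b , c) = joins (colour (p a)) (colour (p b)) (colour (p c))

paintNew : Painting → ℕ → Face → Paint
paintNew p w (a , b , c) = paint (newColour (colour (p a)) (colour (p b)) (colour (p c)))
                                 (if joinsAt p (a , b , c) then root (p c) else w)

paints : ℕ → Painting
paints zero    u = paint (u mod 3) u
paints (suc j)   = extend (paintNew (paints j)) (paints j) (order j) (innerFaces j)

members : Painting → ℕ → ℕ → ℕ
members p N X = countFrom (λ u → is X (root (p u))) 0 N

-- The faces through which the component rooted at X gains a vertex at the next level.
ownedJoin : Painting → ℕ → Face → Bool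
ownedJoin p X (a , b , c) = joinsAt p (a , b , c) ∧ is X (root (p c))

joiners : Painting → ℕ → List Face → ℕ
joiners p X fs = sum (map (𝟙 ∘ ownedJoin p X) fs)

joiners-none : ∀ p X {fs} → All (λ F → ownedJoin p X F ≡ false) fs → joiners p X fs ≡ 0
joiners-none p X []             = refl
joiners-none p X (none ∷ nones) = cong₂ _+_ (cong 𝟙 none) (joiners-none p X nones)

module _ (X : ℕ) where

  root-weight : ∀ joined r w → 𝟙 (is X (if joined then r else w)) ≤ 𝟙 (joined ∧ is X r) + 𝟙 (is X w)
  root-weight true  r w = m≤m+n _ _
  root-weight false r w = ≤-refl

  branch-weight : ∀ joined r w →
    (if joined then 1 else 2) * 𝟙 (is X (if joined then r else w)) ≤ 𝟙 (joined ∧ is X r) + 2 * 𝟙 (is X w)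
  branch-weight true  r w = ≤-trans (≤-reflexive (*-identityˡ _)) (m≤m+n _ _)
  branch-weight false r w = ≤-refl

  subFace-weight : ∀ x y z r w → let n = newColour x y z ; counted = is X (if joins x y z then r else w) in
    𝟙 (joins x y n ∧ counted) + 𝟙 (joins y z n ∧ counted) + 𝟙 (joins x z n ∧ counted)
      ≤ 𝟙 (joins x y z ∧ is X r) + 2 * 𝟙 (is X w)
  subFace-weight x y z r w = begin
    𝟙 (b₁ ∧ counted) + 𝟙 (b₂ ∧ counted) + 𝟙 (b₃ ∧ counted)
      ≡⟨ cong₂ _+_ (cong₂ _+_ (𝟙-∧ b₁ counted) (𝟙-∧ b₂ counted)) (𝟙-∧ b₃ counted) ⟩
    𝟙 b₁ * 𝟙 counted + 𝟙 b₂ * 𝟙 counted + 𝟙 b₃ * 𝟙 counted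
      ≡⟨ trans (*-distribʳ-+ (𝟙 counted) (𝟙 b₁ + 𝟙 b₂) (𝟙 b₃))
               (cong (_+ 𝟙 b₃ * 𝟙 counted) (*-distribʳ-+ (𝟙 counted) (𝟙 b₁) (𝟙 b₂))) ⟨
    (𝟙 b₁ + 𝟙 b₂ + 𝟙 b₃) * 𝟙 counted
      ≤⟨ *-monoˡ-≤ (𝟙 counted) (joining-subFaces x y z) ⟩
    (if joined then 1 else 2) * 𝟙 counted
      ≤⟨ branch-weight joined r w ⟩
    𝟙 (joined ∧ is X r) + 2 * 𝟙 (is X w) ∎
    where
    open ≤-Reasoning
    n = newColour x y z
    joined = joins x y z
    counted = is X (if joined then r else w)
    b₁ = joins x y n
    b₂ = joins y z n
    b₃ = joins x z n

Fresh : Painting → Painting → ℕ → List Face → Set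
Fresh p p′ v fs = ∀ {w F} → Inserts v fs w F → p′ w ≡ paintNew p w F × Corners (λ c → p′ c ≡ p c) F

module Repaint (p p′ : Painting) (X : ℕ) where

  new-members : ∀ v fs → Fresh p p′ v fs →
    countFrom (λ u → is X (root (p′ u))) v (length fs) ≤ joiners p X fs + countFrom (is X) v (length fs)
  new-members v []                 fresh = z≤n
  new-members v ((a , b , c) ∷ fs) fresh with fresh here
  ... | p′v , _ = begin
    𝟙 (is X (root (p′ v))) + countFrom (λ u → is X (root (p′ u))) (suc v) (length fs)
      ≤⟨ +-mono-≤ (≤-reflexive (cong (λ q → 𝟙 (is X (root q))) p′v)) (new-members (suc v) fs (fresh ∘ there)) ⟩
    𝟙 (is X (root (paintNew p v (a , b , c)))) + (joiners p X fs + countFrom (is X) (suc v) (length fs))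
      ≤⟨ +-monoˡ-≤ _ (root-weight X (joinsAt p (a , b , c)) (root (p c)) v) ⟩
    𝟙 (ownedJoin p X (a , b , c)) + 𝟙 (is X v) + (joiners p X fs + countFrom (is X) (suc v) (length fs))
      ≡⟨ +-interchange (𝟙 (ownedJoin p X (a , b , c))) _ _ _ ⟩
    joiners p X ((a , b , c) ∷ fs) + countFrom (is X) v (length ((a , b , c) ∷ fs)) ∎
    where open ≤-Reasoning

  subFace-joiners : ∀ {a b c w} → p′ w ≡ paintNew p w (a , b , c) → Corners (λ u → p′ u ≡ p u) (a , b , c) →
    𝟙 (ownedJoin p′ X (a , b , w)) + 𝟙 (ownedJoin p′ X (b , c , w)) + 𝟙 (ownedJoin p′ X (a , c , w))
      ≤ 𝟙 (ownedJoin p X (a , b , c)) + 2 * 𝟙 (is X w)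
  subFace-joiners {a} {b} {c} {w} p′w (p′a , p′b , p′c) rewrite p′w | p′a | p′b | p′c =
    subFace-weight X (colour (p a)) (colour (p b)) (colour (p c)) (root (p c)) w

  new-joiners : ∀ v fs → Fresh p p′ v fs →
    joiners p′ X (newFaces v fs) ≤ joiners p X fs + 2 * countFrom (is X) v (length fs)
  new-joiners v []                 fresh = z≤n
  new-joiners v ((a , b , c) ∷ fs) fresh with fresh here
  ... | p′v , p′corners = begin
    s₁ + (s₂ + (s₃ + joiners p′ X (newFaces (suc v) fs)))
      ≡⟨ trans (+-assoc (s₁ + s₂) s₃ _) (+-assoc s₁ s₂ _) ⟨
    s₁ + s₂ + s₃ + joiners p′ X (newFaces (suc v) fs)
      ≤⟨ +-mono-≤ (subFace-joiners p′v p′corners) (new-joiners (suc v) fs (fresh ∘ there)) ⟩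
    𝟙 (ownedJoin p X (a , b , c)) + 2 * 𝟙 (is X v) + (joiners p X fs + 2 * countFrom (is X) (suc v) (length fs))
      ≡⟨ +-interchange (𝟙 (ownedJoin p X (a , b , c))) _ _ _ ⟩
    joiners p X ((a , b , c) ∷ fs) + (2 * 𝟙 (is X v) + 2 * countFrom (is X) (suc v) (length fs))
      ≡⟨ cong (joiners p X ((a , b , c) ∷ fs) +_) (*-distribˡ-+ 2 (𝟙 (is X v)) (countFrom (is X) (suc v) (length fs))) ⟨
    joiners p X ((a , b , c) ∷ fs) + 2 * countFrom (is X) v (length ((a , b , c) ∷ fs)) ∎
    where
    open ≤-Reasoning
    s₁ = 𝟙 (ownedJoin p′ X (a , b , v))
    s₂ = 𝟙 (ownedJoin p′ X (b , c , v))
    s₃ = 𝟙 (ownedJoin p′ X (a , c , v))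

record Invariant (j : ℕ) : Set where
  field
    monochromatic-edge : ∀ {x y} → (x , y) ∈ edges (tree j) →
      colour (paints j x) ≡ colour (paints j y) → root (paints j x) ≡ root (paints j y)
    root-≤    : ∀ u → root (paints j u) ≤ u
    members-≤ : ∀ X → members (paints j) (order j) X ≤ 2 * j + 1
    joiners-≤ : ∀ X → joiners (paints j) X (innerFaces j) ≤ 2

invariant-base : Invariant 0
invariant-base = record
  { monochromatic-edge = λ { (here refl) () ; (there (here refl)) () ; (there (there (here refl))) () }
  ; root-≤    = λ u → ≤-refl
  ; members-≤ = λ X → countFrom-is X 0 3
  ; joiners-≤ = λ X → ≤-trans (+-monoˡ-≤ 0 (𝟙≤1 _)) (s≤s z≤n)
  }

2*j+1+2 : ∀ j → 2 * j + 1 + 2 ≡ 2 * suc j + 1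
2*j+1+2 = solve-∀

if-≤ : ∀ b {r u} → r ≤ u → (if b then r else u) ≤ u
if-≤ true  r≤u = r≤u
if-≤ false r≤u = ≤-refl

module NextLevel (j : ℕ) (I : Invariant j) where
  open Invariant I

  private
    N  = order j
    Fs = innerFaces j
    p  = paints j
    p′ = paints (suc j)

  p′-old : u < N → p′ u ≡ p u
  p′-old = extend-old N Fs

  fresh : Fresh p p′ N Fs
  fresh ins with innerFace-corners j (Inserts⇒∈ ins)
  ... | a< , b< , c< = extend-new ins , p′-old a< , p′-old b< , p′-old c<

  monochromatic-edge′ : ∀ {x y} → (x , y) ∈ edges (tree (suc j)) →
    colour (p′ x) ≡ colour (p′ y) → root (p′ x) ≡ root (p′ y)
  monochromatic-edge′ e∈ with ∈-++⁻ (edges (tree j)) (subst (_ ∈_) (edges-suc j) e∈)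
  ... | inj₁ old with edge-ends j old
  ...   | x< , y< rewrite p′-old x< | p′-old y< = monochromatic-edge old
  monochromatic-edge′ e∈ | inj₂ new with newEdge⇒spoke N Fs new
  ... | w , (a , b , c) , ins , spk with fresh ins
  ...   | p′w , p′a , p′b , p′c = spoke-case spk
    where
    x′ = colour (p a)
    y′ = colour (p b)
    z′ = colour (p c)
    spoke-case : ∀ {x y} → Spoke w (a , b , c) (x , y) →
      colour (p′ x) ≡ colour (p′ y) → root (p′ x) ≡ root (p′ y)
    spoke-case to-a same rewrite p′w | p′a = ⊥-elim (newColour-≢₁ x′ y′ z′ same)
    spoke-case to-b same rewrite p′w | p′b = ⊥-elim (newColour-≢₂ x′ y′ z′ same)
    spoke-case to-c same rewrite p′w | p′c | dec-true (newColour x′ y′ z′ ≟ᶠ z′) same = refl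

  root-≤′ : ∀ u → root (p′ u) ≤ u
  root-≤′ u with extend-cases {new = paintNew p} {old = p} N Fs u
  ... | inj₁ p′u = subst (λ q → root q ≤ u) (sym p′u) (root-≤ u)
  ... | inj₂ ((a , b , c) , ins , p′u) = subst (λ q → root q ≤ u) (sym p′u)
          (if-≤ (joinsAt p (a , b , c)) (≤-trans (root-≤ c) (<⇒≤ (<-≤-trans c< (proj₁ (inserted-label j ins))))))
    where c< = proj₂ (proj₂ (innerFace-corners j (Inserts⇒∈ ins)))

  members-split : ∀ X →
    members p′ (order (suc j)) X ≤ members p N X + (joiners p X Fs + countFrom (is X) N (length Fs))
  members-split X = begin
    members p′ (order (suc j)) X
      ≡⟨ cong (λ M → members p′ M X) (nextLabel≡ N Fs) ⟩
    countFrom q′ 0 (N + length Fs)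
      ≡⟨ countFrom-+ q′ 0 N (length Fs) ⟩
    countFrom q′ 0 N + countFrom q′ N (length Fs)
      ≤⟨ +-mono-≤ (≤-reflexive (countFrom-cong 0 N λ u _ u< → cong (is X ∘ root) (p′-old u<)))
                  (Repaint.new-members p p′ X N Fs fresh) ⟩
    members p N X + (joiners p X Fs + countFrom (is X) N (length Fs)) ∎
    where
    open ≤-Reasoning
    q′ = λ u → is X (root (p′ u))

  unrooted : ∀ {X} → N ≤ X → members p N X ≡ 0 × joiners p X Fs ≡ 0
  unrooted {X} N≤X =
    countFrom-none 0 N (λ u _ u< → not-X (≤-<-trans (root-≤ u) u<)) ,
    joiners-none p X (All.tabulate λ F∈ → not-owned (innerFace-corners j F∈))
    where
    not-X : ∀ {r} → r < N → is X r ≡ false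
    not-X r< = dec-false (_ ≟ X) (<⇒≢ (<-≤-trans r< N≤X))
    not-owned : ∀ {F} → Corners (_< N) F → ownedJoin p X F ≡ false
    not-owned {a , b , c} (_ , _ , c<) =
      trans (cong (joinsAt p (a , b , c) ∧_) (not-X (≤-<-trans (root-≤ c) c<))) (∧-zeroʳ _)

  members-≤′ : ∀ X → members p′ (order (suc j)) X ≤ 2 * suc j + 1
  members-≤′ X with X <? N
  ... | yes X<N = begin
    members p′ (order (suc j)) X
      ≤⟨ members-split X ⟩
    members p N X + (joiners p X Fs + countFrom (is X) N (length Fs))
      ≡⟨ cong (λ c → members p N X + (joiners p X Fs + c)) (countFrom-is-below N (length Fs) X<N) ⟩
    members p N X + (joiners p X Fs + 0)
      ≤⟨ +-mono-≤ (members-≤ X) (+-monoˡ-≤ 0 (joiners-≤ X)) ⟩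
    2 * j + 1 + 2
      ≡⟨ 2*j+1+2 j ⟩
    2 * suc j + 1 ∎
    where open ≤-Reasoning
  ... | no X≮N with unrooted (≮⇒≥ X≮N)
  ...   | no-members , no-joiners = begin
    members p′ (order (suc j)) X
      ≤⟨ members-split X ⟩
    members p N X + (joiners p X Fs + countFrom (is X) N (length Fs))
      ≡⟨ cong₂ (λ m f → m + (f + countFrom (is X) N (length Fs))) no-members no-joiners ⟩
    countFrom (is X) N (length Fs)
      ≤⟨ countFrom-is X N (length Fs) ⟩
    1
      ≤⟨ m≤n+m 1 (2 * suc j) ⟩
    2 * suc j + 1 ∎
    where open ≤-Reasoning

  joiners-≤′ : ∀ X → joiners p′ X (innerFaces (suc j)) ≤ 2
  joiners-≤′ X with X <? N
  ... | yes X<N = begin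
    joiners p′ X (newFaces N Fs)
      ≤⟨ Repaint.new-joiners p p′ X N Fs fresh ⟩
    joiners p X Fs + 2 * countFrom (is X) N (length Fs)
      ≡⟨ cong (λ c → joiners p X Fs + 2 * c) (countFrom-is-below N (length Fs) X<N) ⟩
    joiners p X Fs + 0
      ≡⟨ +-identityʳ _ ⟩
    joiners p X Fs
      ≤⟨ joiners-≤ X ⟩
    2 ∎
    where open ≤-Reasoning
  ... | no X≮N = begin
    joiners p′ X (newFaces N Fs)
      ≤⟨ Repaint.new-joiners p p′ X N Fs fresh ⟩
    joiners p X Fs + 2 * countFrom (is X) N (length Fs)
      ≡⟨ cong (_+ 2 * countFrom (is X) N (length Fs)) (proj₂ (unrooted (≮⇒≥ X≮N))) ⟩
    2 * countFrom (is X) N (length Fs)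
      ≤⟨ *-monoʳ-≤ 2 (countFrom-is X N (length Fs)) ⟩
    2 ∎
    where open ≤-Reasoning

  invariant-step : Invariant (suc j)
  invariant-step = record
    { monochromatic-edge = monochromatic-edge′
    ; root-≤             = root-≤′
    ; members-≤          = members-≤′
    ; joiners-≤          = joiners-≤′
    }

invariant : ∀ j → Invariant j
invariant zero    = invariant-base
invariant (suc j) = NextLevel.invariant-step j (invariant j)

module UpperBound (K : ℕ) where
  open Invariant (invariant K)

  χ : Coloring 3
  χ u = colour (paints K u)

  same-root : ∀ {x u} → MonoPath (tree K) χ x u → x < order K →
    u < order K × root (paints K u) ≡ root (paints K x)
  same-root here                      x< = x< , refl
  same-root (step (inj₁ xw∈) xw path) _  with same-root path (proj₂ (edge-ends K xw∈))
  ... | u< , uw = u< , trans uw (sym (monochromatic-edge xw∈ xw))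
  same-root (step (inj₂ wx∈) xw path) _  with same-root path (proj₁ (edge-ends K wx∈))
  ... | u< , uw = u< , trans uw (monochromatic-edge wx∈ (sym xw))

  small-components : AllMonoComponentsAtMost (tree K) χ (2 * K + 1)
  small-components x x< xs xs! reached =
    ≤-trans (unique-≤-countFrom xs! (All.map in-component reached)) (members-≤ (root (paints K x)))
    where
    in-component : ∀ {u} → MonoPath (tree K) χ x u →
      u < order K × is (root (paints K x)) (root (paints K u)) ≡ true
    in-component path with same-root path x<
    ... | u< , ux = u< , dec-true (_ ≟ _) ux

mcc-≥ : ∀ k m → IsMcc (tree k) 3 m → 3 + k ≤ 3 * m
mcc-≥ k m ((χ , small) , _) = LowerBound.large-component k χ small

mcc-≤ : ∀ k m → IsMcc (tree k) 3 m → m ≤ 2 * k + 1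
mcc-≤ k m (_ , least) = least (2 * k + 1) (UpperBound.χ k , UpperBound.small-components k)

log-order-≤-6*mcc : ∀ k m → IsMcc (tree k) 3 m → ⌊log₂ order k ⌋ ≤ 6 * m
log-order-≤-6*mcc k m mcc = begin
  ⌊log₂ order k ⌋  ≤⟨ log-order-≤ k ⟩
  2 * suc k        ≤⟨ *-monoʳ-≤ 2 (m≤n+m (suc k) 2) ⟩
  2 * (3 + k)      ≤⟨ *-monoʳ-≤ 2 (mcc-≥ k m mcc) ⟩
  2 * (3 * m)      ≡⟨ *-assoc 2 3 m ⟨
  6 * m            ∎
  where open ≤-Reasoning

mcc-≤-3*log-order : ∀ k m → IsMcc (tree (suc k)) 3 m → m ≤ 3 * ⌊log₂ order (suc k) ⌋
mcc-≤-3*log-order k m mcc = begin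
  m                      ≤⟨ mcc-≤ (suc k) m mcc ⟩
  2 * suc k + 1          ≤⟨ +-monoʳ-≤ (2 * suc k) (s≤s z≤n) ⟩
  2 * suc k + 1 * suc k  ≡⟨ *-distribʳ-+ (suc k) 2 1 ⟨
  3 * suc k              ≤⟨ *-monoʳ-≤ 3 (log-order-≥ (suc k)) ⟩
  3 * ⌊log₂ order (suc k) ⌋ ∎
  where open ≤-Reasoning

theorem4 : ∃ λ (cn : ℕ) → ∃ λ (cd : ℕ) → ∃ λ (Cn : ℕ) → ∃ λ (Cd : ℕ) → ∃ λ (n₀ : ℕ) →
    0 < cn × 0 < cd × 0 < Cn × 0 < Cd ×
    (∀ (k m : ℕ) → n₀ ≤ size (completePlanar3Tree k) →
      IsMcc (completePlanar3Tree k) 3 m →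
      cn * ⌊log₂ size (completePlanar3Tree k) ⌋ ≤ cd * m ×
      Cd * m ≤ Cn * ⌊log₂ size (completePlanar3Tree k) ⌋)
theorem4 = 1 , 6 , 3 , 1 , 4 , s≤s z≤n , s≤s z≤n , s≤s z≤n , s≤s z≤n , bounds
  where
  bounds : ∀ k m → 4 ≤ order k → IsMcc (tree k) 3 m →
    1 * ⌊log₂ order k ⌋ ≤ 6 * m × 1 * m ≤ 3 * ⌊log₂ order k ⌋
  bounds zero    m (s≤s (s≤s (s≤s ()))) _
  bounds (suc k) m _ mcc =
    subst (_≤ 6 * m) (sym (*-identityˡ _)) (log-order-≤-6*mcc (suc k) m mcc) ,
    subst (_≤ 3 * ⌊log₂ order (suc k) ⌋) (sym (*-identityˡ m)) (mcc-≤-3*log-order k m mcc)
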